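{- Let $S$ be a set and let $\mathrm{cl}:\mathcal{P}(S)\to\mathcal{P}(S)$ be a closure operator on $S$. Let $\Lambda$ be a lower set of the closure system $(S,\mathrm{cl})$. Define $\mathrm{cl}_\Lambda:\mathcal{P}(S)\to\mathcal{P}(S)$ by \[ \mathrm{cl}_\Lambda(A)=\begin{cases}\mathrm{cl}(A) & \text{if } \mathrm{cl}(A)\in\Lambda,\\ S & \text{otherwise.}\end{cases} \] Then $\mathrm{cl}_\Lambda$ is a closure operator on $S$.
   Context: A closure operator on a set $S$ is a map $\mathrm{cl}:\mathcal{P}(S)\to\mathcal{P}(S)$ on the power set of $S$ such that for all $A,B\subseteq S$: (i) $A\subseteq \mathrm{cl}(A)$; (ii) $A\subseteq B$ implies $\mathrm{cl}(A)\subseteq\mathrm{cl}(B)$; (iii) $\mathrm{cl}(\mathrm{cl}(A))=\mathrm{cl}(A)$. A subset $A\subseteq S$ is closed if $\mathrm{cl}(A)=A$. A lower set $\Lambda$ of $(S,\mathrm{cl})$ is a collection of closed sets such that for all closed sets $A\subseteq B$, $B\in\Lambda$ implies $A\in\Lambda$. -}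

module Defs where

open import Level using (Level; _⊔_; suc)
open import Data.Product using (_×_)
open import Data.Unit.Polymorphic using (⊤)
open import Relation.Unary using (Pred; _⊆_; _≐_; _∈_)
open import Relation.Nullary using (yes; no)
open import Axiom.ExcludedMiddle using (ExcludedMiddle)

record IsClosureOperator {a ℓ : Level} {S : Set a}
         (cl : Pred S ℓ → Pred S ℓ) : Set (a ⊔ suc ℓ) where
  field
    extensive  : ∀ A → A ⊆ cl A
    monotone   : ∀ {A B} → A ⊆ B → cl A ⊆ cl B
    idempotent : ∀ A → cl (cl A) ≐ cl A

Closed : ∀ {a ℓ} {S : Set a} → (Pred S ℓ → Pred S ℓ) → Pred S ℓ → Set (a ⊔ ℓ)
Closed cl A = cl A ≐ A

IsLowerSet : ∀ {a ℓ ℓ'} {S : Set a} → (Pred S ℓ → Pred S ℓ) →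
             Pred (Pred S ℓ) ℓ' → Set (a ⊔ suc ℓ ⊔ ℓ')
IsLowerSet cl Λ =
  (∀ A → A ∈ Λ → Closed cl A) ×
  (∀ A B → Closed cl A → Closed cl B → A ⊆ B → B ∈ Λ → A ∈ Λ)

Full : ∀ {a ℓ} {S : Set a} → Pred S ℓ
Full = λ _ → ⊤

clΛ : ∀ {a ℓ ℓ'} {S : Set a} → ExcludedMiddle ℓ' →
      (Pred S ℓ → Pred S ℓ) → Pred (Pred S ℓ) ℓ' → Pred S ℓ → Pred S ℓ
clΛ lem cl Λ A with lem {cl A ∈ Λ}
... | yes _ = cl A
... | no  _ = Full

module Submission where

-- Call a subset A admissible when cl(A) ∈ Λ; then cl_Λ(A) is cl(A) for
-- admissible A and the whole set S otherwise.  The proof rests on one fact: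
-- admissibility is inherited downwards, i.e. if cl(A) ⊆ cl(B) and B is
-- admissible then so is A, because cl(A) and cl(B) are closed and Λ is a
-- lower set.  Two instances of it are used: A ⊆ B (via monotonicity of cl)
-- gives monotonicity of cl_Λ, and cl(cl(A)) ⊆ cl(A) shows that cl(A) is
-- admissible whenever A is, which gives idempotence.  Besides this, S itself
-- is closed, which settles idempotence in the inadmissible case.

open import Defs
open import Level using (Level)
open import Relation.Unary using (Pred; _⊆_; _∈_; _≐_)
open import Relation.Unary.Properties using (≐-refl; ≐-trans)
open import Relation.Nullary using (¬_; yes; no)
open import Axiom.ExcludedMiddle using (ExcludedMiddle)
open import Data.Product using (_,_; proj₁; proj₂)
open import Data.Unit.Polymorphic using (tt)
open import Data.Empty using (⊥-elim)

module ClosureOperatorFacts {a ℓ : Level} {S : Set a}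
         {cl : Pred S ℓ → Pred S ℓ} (isClosure : IsClosureOperator cl) where

  open IsClosureOperator isClosure

  ⊆-Full : ∀ (A : Pred S ℓ) → A ⊆ Full {ℓ = ℓ}
  ⊆-Full A _ = tt

  cl-closed : ∀ A → Closed cl (cl A)
  cl-closed = idempotent

  Full-closed : Closed cl Full
  Full-closed = ⊆-Full (cl Full) , extensive Full

module Truncation {a ℓ ℓ' : Level} {S : Set a} (lem : ExcludedMiddle ℓ')
         {cl : Pred S ℓ → Pred S ℓ} (isClosure : IsClosureOperator cl)
         (Λ : Pred (Pred S ℓ) ℓ') (isLower : IsLowerSet cl Λ) where

  open IsClosureOperator isClosure
  open ClosureOperatorFacts isClosure

  clΛ′ : Pred S ℓ → Pred S ℓ
  clΛ′ = clΛ lem cl Λ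

  Admissible : Pred S ℓ → Set ℓ'
  Admissible A = cl A ∈ Λ

  -- Admissibility is inherited along inclusions of closures, since Λ is a
  -- lower set and closures are closed.
  admissible-downward : ∀ {A B} → cl A ⊆ cl B → Admissible B → Admissible A
  admissible-downward {A} {B} clA⊆clB =
    proj₂ isLower (cl A) (cl B) (cl-closed A) (cl-closed B) clA⊆clB

  admissible-cl : ∀ {A} → Admissible A → Admissible (cl A)
  admissible-cl {A} = admissible-downward (proj₁ (idempotent A))

  clΛ-admissible : ∀ A → Admissible A → clΛ′ A ≐ cl A
  clΛ-admissible A adm with lem {cl A ∈ Λ}
  ... | yes _   = ≐-refl
  ... | no ¬adm = ⊥-elim (¬adm adm)

  clΛ-Full : clΛ′ Full ≐ Full
  clΛ-Full with lem {cl Full ∈ Λ}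
  ... | yes _ = Full-closed
  ... | no _  = ≐-refl

  clΛ-extensive : ∀ A → A ⊆ clΛ′ A
  clΛ-extensive A with lem {cl A ∈ Λ}
  ... | yes _ = extensive A
  ... | no _  = ⊆-Full A

  -- Monotonicity: the only nontrivial case, B admissible but A not, is
  -- impossible for A ⊆ B by downward inheritance.
  clΛ-monotone : ∀ {A B} → A ⊆ B → clΛ′ A ⊆ clΛ′ B
  clΛ-monotone {A} {B} A⊆B with lem {cl A ∈ Λ} | lem {cl B ∈ Λ}
  ... | _       | no _    = λ _ → tt
  ... | yes _   | yes _   = monotone A⊆B
  ... | no ¬adm | yes adm = ⊥-elim (¬adm (admissible-downward (monotone A⊆B) adm))

  clΛ-idempotent : ∀ A → clΛ′ (clΛ′ A) ≐ clΛ′ A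
  clΛ-idempotent A with lem {cl A ∈ Λ}
  ... | yes adm = ≐-trans (clΛ-admissible (cl A) (admissible-cl adm)) (idempotent A)
  ... | no _    = clΛ-Full

  clΛ-isClosure : IsClosureOperator clΛ′
  clΛ-isClosure = record
    { extensive  = clΛ-extensive
    ; monotone   = clΛ-monotone
    ; idempotent = clΛ-idempotent
    }

proposition2p6 : ∀ {a ℓ ℓ'} {S : Set a} (lem : ExcludedMiddle ℓ')
                 (cl : Pred S ℓ → Pred S ℓ) → IsClosureOperator cl →
                 (Λ : Pred (Pred S ℓ) ℓ') → IsLowerSet cl Λ →
                 IsClosureOperator (clΛ lem cl Λ)
proposition2p6 lem cl isClosure Λ isLower =
  Truncation.clΛ-isClosure lem isClosure Λ isLower
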